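{- Let $G\in\mathscr{F}_{n,3}$, let $i$ be an interior vertex ($2\le i\le n$), and let $(a,d)$ be the unique edge of $G$ with $a<i<d$. Then every integral flow $f$ on $G$ with netflow $\mathbf{w}_n=(0,1,\dots,1,-(n-1))$ has exactly $i-2-f(a,d)$ units of flow entering vertex $i$.
   Context: DAGs have vertex set $[n+1]$ and a multiset of edges $(i,j)$ with $i<j$ (parallel edges allowed). $\mathscr{F}_{n,3}$ is the set of such DAGs with out-degree sequence $(3,2,\dots,2,0)$ and in-degree sequence $(0,2,\dots,2,3)$. For each interior vertex $i$ of $G\in\mathscr{F}_{n,3}$ there is exactly one edge $(a,d)$ (counted with multiplicity) with $a<i<d$. An integral flow with netflow $\mathbf{a}$ is $f:E(G)\to\mathbb{Z}_{\ge0}$ with outflow minus inflow at each vertex $v$ equal to $a_v$. -}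

module Defs where

open import Data.Nat using (ℕ; zero; suc; _+_; _≤_; _<_; _≟_)
open import Data.Integer as ℤ using (ℤ; +_; -_)
open import Data.Fin using (Fin)
open import Data.List using (List; length; filter; map; allFin; lookup)
open import Data.Nat.ListAction using (sum)
open import Relation.Nullary using (yes; no)
open import Data.List.Relation.Unary.All using (All)
open import Data.Product using (_×_; _,_; proj₁; proj₂)
open import Data.Bool using (if_then_else_)
open import Relation.Nullary.Decidable using (⌊_⌋)
open import Relation.Binary.PropositionalEquality using (_≡_)

-- A DAG on vertex set [n+1] = {1,…,n+1} is a multiset of edges (i , j) with
-- 1 ≤ i < j ≤ n+1, represented as a list of pairs (parallel edges = repeated entries).
-- Edge copies are identified by their position in the list.
Edge : Set
Edge = ℕ × ℕ

DAG : Set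
DAG = List Edge

ValidEdge : ℕ → Edge → Set
ValidEdge n (i , j) = (1 ≤ i) × (i < j) × (j ≤ suc n)

outdeg : DAG → ℕ → ℕ
outdeg G v = length (filter (λ e → proj₁ e ≟ v) G)

indeg : DAG → ℕ → ℕ
indeg G v = length (filter (λ e → proj₂ e ≟ v) G)

record InF3 (n : ℕ) (G : DAG) : Set where
  field
    valid      : All (ValidEdge n) G
    out-first  : outdeg G 1 ≡ 3
    out-mid    : ∀ v → 2 ≤ v → v ≤ n → outdeg G v ≡ 2
    out-last   : outdeg G (suc n) ≡ 0
    in-first   : indeg G 1 ≡ 0
    in-mid     : ∀ v → 2 ≤ v → v ≤ n → indeg G v ≡ 2
    in-last    : indeg G (suc n) ≡ 3

Flow : DAG → Set
Flow G = Fin (length G) → ℕ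

outflow : (G : DAG) → Flow G → ℕ → ℕ
outflow G f v = sum (map (λ k → if ⌊ proj₁ (lookup G k) ≟ v ⌋ then f k else 0) (allFin (length G)))

inflow : (G : DAG) → Flow G → ℕ → ℕ
inflow G f v = sum (map (λ k → if ⌊ proj₂ (lookup G k) ≟ v ⌋ then f k else 0) (allFin (length G)))

w : ℕ → ℕ → ℤ
w n v with v ≟ 1
... | yes _ = + 0
... | no _ with v ≟ suc n
...   | yes _ = - (+ n ℤ.- + 1)
...   | no _ = + 1

HasNetflow : (n : ℕ) (G : DAG) → Flow G → (ℕ → ℤ) → Set
HasNetflow n G f a = ∀ v → 1 ≤ v → v ≤ suc n → (+ outflow G f v) ℤ.- (+ inflow G f v) ≡ a v

module Submission where

open import Defs
open import Data.Nat using (ℕ; _≤_; _<_)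
open import Data.Integer as ℤ using (ℤ; +_)
open import Data.Fin using (Fin)
open import Data.List using (length; lookup)
open import Data.Product using (_×_; _,_)
open import Relation.Binary.PropositionalEquality using (_≡_)

open import Data.Nat using (zero; suc; _+_; _*_; z≤n; s≤s; _≟_; _<?_)
open import Data.Nat.Properties
open import Data.Nat.Tactic.RingSolver using (solve-∀)
import Data.Integer.Properties as ℤ
import Data.Integer.Tactic.RingSolver as ℤ-Solver
open import Data.Fin using () renaming (zero to fzero; suc to fsuc)
open import Data.List using ([]; _∷_; filter; map; allFin; tabulate)
open import Data.List.Properties using (map-tabulate)
open import Data.List.Relation.Unary.All as All using (All; []; _∷_)
open import Data.Nat.ListAction using (sum)
open import Data.Product using (proj₁; proj₂)
open import Data.Bool using (Bool; true; false; if_then_else_)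
open import Function using (_∘_)
open import Relation.Nullary using (Dec; yes; no; ¬_; contradiction; _×-dec_)
open import Relation.Nullary.Decidable using (⌊_⌋)
open import Relation.Binary using (tri<; tri≈; tri>)
open import Relation.Binary.PropositionalEquality using (refl; sym; trans; cong; cong₂; subst; module ≡-Reasoning)

-- Cut the vertices into {1,…,i-1} and {i,…,n+1}.  Summing "outflow − inflow" over
-- the left part counts exactly the flow on the edges leaving it: the edges into i
-- and the edges spanning i.  For the flow f this sum is i-2 (netflow 0 at vertex 1,
-- 1 at the others), and for the unit flow, i.e. for degrees, it is 3.  Since i has
-- in-degree 2, exactly one edge spans i, namely (a,d), which carries f(a,d).

𝟙 : {A : Set} → Dec A → ℕ
𝟙 a? = if ⌊ a? ⌋ then 1 else 0

𝟙-yes : {A : Set} (a? : Dec A) → A → 𝟙 a? ≡ 1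
𝟙-yes (yes _) _ = refl
𝟙-yes (no ¬a) a = contradiction a ¬a

𝟙-no : {A : Set} (a? : Dec A) → ¬ A → 𝟙 a? ≡ 0
𝟙-no (yes a) ¬a = contradiction a ¬a
𝟙-no (no _)  _  = refl

𝟙-×-dec-yesʳ : {A B : Set} (a? : Dec A) (b? : Dec B) → B → 𝟙 (a? ×-dec b?) ≡ 𝟙 a?
𝟙-×-dec-yesʳ (yes a) b? b = 𝟙-yes (yes a ×-dec b?) (a , b)
𝟙-×-dec-yesʳ (no ¬a) b? b = 𝟙-no (no ¬a ×-dec b?) (¬a ∘ proj₁)

𝟙[<]+𝟙[≡]≡𝟙[≤] : ∀ x i → 𝟙 (x <? i) + 𝟙 (x ≟ i) ≡ 𝟙 (x <? suc i)
𝟙[<]+𝟙[≡]≡𝟙[≤] x i with <-cmp x i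
... | tri< x<i x≢i _ rewrite 𝟙-yes (x <? i) x<i | 𝟙-no (x ≟ i) x≢i
                           | 𝟙-yes (x <? suc i) (m≤n⇒m≤1+n x<i) = refl
... | tri≈ x≮i x≡i _ rewrite 𝟙-no (x <? i) x≮i | 𝟙-yes (x ≟ i) x≡i
                           | 𝟙-yes (x <? suc i) (s≤s (≤-reflexive x≡i)) = refl
... | tri> x≮i x≢i i<x rewrite 𝟙-no (x <? i) x≮i | 𝟙-no (x ≟ i) x≢i
                             | 𝟙-no (x <? suc i) (<⇒≱ i<x ∘ ≤-pred) = refl

sumTo : ℕ → (ℕ → ℕ) → ℕ
sumTo zero    g = 0
sumTo (suc m) g = sumTo m g + g (suc m)

sumTo-cong : ∀ m {g h : ℕ → ℕ} → (∀ v → g v ≡ h v) → sumTo m g ≡ sumTo m h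
sumTo-cong zero    g≗h = refl
sumTo-cong (suc m) g≗h = cong₂ _+_ (sumTo-cong m g≗h) (g≗h (suc m))

sumTo-𝟙[≡] : ∀ {x} m → 1 ≤ x → sumTo m (λ v → 𝟙 (x ≟ v)) ≡ 𝟙 (x <? suc m)
sumTo-𝟙[≡] {x} zero    1≤x = sym (𝟙-no (x <? 1) (<⇒≱ 1≤x ∘ ≤-pred))
sumTo-𝟙[≡] {x} (suc m) 1≤x =
  trans (cong (_+ 𝟙 (x ≟ suc m)) (sumTo-𝟙[≡] m 1≤x)) (𝟙[<]+𝟙[≡]≡𝟙[≤] x (suc m))

sumTo-excess : ∀ {n} (A B : ℕ → ℕ) (c₀ δ : ℕ) → A 1 ≡ B 1 + c₀ →
               (∀ v → 2 ≤ v → v ≤ n → A v ≡ B v + δ) →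
               ∀ t → suc t ≤ n → sumTo (suc t) A ≡ sumTo (suc t) B + (c₀ + t * δ)
sumTo-excess A B c₀ δ first mid zero    _ =
  cong (_+_ 0) (trans first (cong (_+_ (B 1)) (sym (+-identityʳ c₀))))
sumTo-excess A B c₀ δ first mid (suc t) t+2≤n = begin
  sumTo (suc t) A + A (2 + t)                               ≡⟨ cong₂ _+_ (sumTo-excess A B c₀ δ first mid t (≤-trans (n≤1+n _) t+2≤n))
                                                                         (mid (2 + t) (s≤s (s≤s z≤n)) t+2≤n) ⟩
  (sumTo (suc t) B + (c₀ + t * δ)) + (B (2 + t) + δ)         ≡⟨ regroup (sumTo (suc t) B) (B (2 + t)) c₀ t δ ⟩
  (sumTo (suc t) B + B (2 + t)) + (c₀ + suc t * δ)          ∎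
  where
  open ≡-Reasoning
  regroup : ∀ S b c t δ → (S + (c + t * δ)) + (b + δ) ≡ (S + b) + (c + suc t * δ)
  regroup = solve-∀

edgeSum : (G : DAG) → Flow G → (Edge → ℕ) → ℕ
edgeSum []      c h = 0
edgeSum (e ∷ G) c h = h e * c fzero + edgeSum G (c ∘ fsuc) h

edgeSum-zero : ∀ G (c : Flow G) → edgeSum G c (λ _ → 0) ≡ 0
edgeSum-zero []      c = refl
edgeSum-zero (e ∷ G) c = edgeSum-zero G (c ∘ fsuc)

edgeSum-+ : ∀ G (c : Flow G) (h₁ h₂ : Edge → ℕ) →
            edgeSum G c (λ e → h₁ e + h₂ e) ≡ edgeSum G c h₁ + edgeSum G c h₂
edgeSum-+ []      c h₁ h₂ = refl
edgeSum-+ (e ∷ G) c h₁ h₂ =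
  trans (cong (_+_ ((h₁ e + h₂ e) * c fzero)) (edgeSum-+ G (c ∘ fsuc) h₁ h₂))
        (interchange (h₁ e) (h₂ e) (c fzero) (edgeSum G (c ∘ fsuc) h₁) (edgeSum G (c ∘ fsuc) h₂))
  where
  interchange : ∀ x y z S T → (x + y) * z + (S + T) ≡ (x * z + S) + (y * z + T)
  interchange = solve-∀

edgeSum-cong : ∀ {P : Edge → Set} {G} (c : Flow G) {h₁ h₂ : Edge → ℕ} → All P G →
               (∀ e → P e → h₁ e ≡ h₂ e) → edgeSum G c h₁ ≡ edgeSum G c h₂
edgeSum-cong c []         h₁≗h₂ = refl
edgeSum-cong c (pe ∷ pes) h₁≗h₂ =
  cong₂ (λ x S → x * c fzero + S) (h₁≗h₂ _ pe) (edgeSum-cong (c ∘ fsuc) pes h₁≗h₂)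

sumTo-edgeSum : ∀ G (c : Flow G) (h : ℕ → Edge → ℕ) m →
                sumTo m (λ v → edgeSum G c (h v)) ≡ edgeSum G c (λ e → sumTo m (λ v → h v e))
sumTo-edgeSum G c h zero    = sym (edgeSum-zero G c)
sumTo-edgeSum G c h (suc m) =
  trans (cong (_+ edgeSum G c (h (suc m))) (sumTo-edgeSum G c h m))
        (sym (edgeSum-+ G c _ (h (suc m))))

unitFlow : (G : DAG) → Flow G
unitFlow G _ = 1

edgeSum-unit≡0⇒≡0 : ∀ G (c : Flow G) h → edgeSum G (unitFlow G) h ≡ 0 → edgeSum G c h ≡ 0
edgeSum-unit≡0⇒≡0 []      c h _  = refl
edgeSum-unit≡0⇒≡0 (e ∷ G) c h eq
  rewrite trans (sym (*-identityʳ (h e))) (m+n≡0⇒m≡0 _ eq) =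
  edgeSum-unit≡0⇒≡0 G (c ∘ fsuc) h (m+n≡0⇒n≡0 (h e * 1) eq)

edgeSum-unit≡0⇒lookup≡0 : ∀ G h → edgeSum G (unitFlow G) h ≡ 0 → ∀ k → h (lookup G k) ≡ 0
edgeSum-unit≡0⇒lookup≡0 (e ∷ G) h eq fzero    = trans (sym (*-identityʳ (h e))) (m+n≡0⇒m≡0 _ eq)
edgeSum-unit≡0⇒lookup≡0 (e ∷ G) h eq (fsuc k) = edgeSum-unit≡0⇒lookup≡0 G h (m+n≡0⇒n≡0 (h e * 1) eq) k

-- The unit-flow count forces e_k to be the only edge of nonzero weight.
edgeSum-unit≡1⇒≡lookup : ∀ G (c : Flow G) h k → edgeSum G (unitFlow G) h ≡ 1 →
                         h (lookup G k) ≡ 1 → edgeSum G c h ≡ c k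
edgeSum-unit≡1⇒≡lookup (e ∷ G) c h fzero eq hk rewrite hk =
  trans (cong₂ _+_ (+-identityʳ (c fzero)) (edgeSum-unit≡0⇒≡0 G (c ∘ fsuc) h (suc-injective eq)))
        (+-identityʳ _)
edgeSum-unit≡1⇒≡lookup (e ∷ G) c h (fsuc k) eq hk with h e
... | zero  = edgeSum-unit≡1⇒≡lookup G (c ∘ fsuc) h k eq hk
... | suc z = contradiction (trans (sym hk) (edgeSum-unit≡0⇒lookup≡0 G h rest≡0 k)) λ ()
  where rest≡0 = m+n≡0⇒n≡0 (z * 1) (suc-injective eq)

sum-if-lookup≡edgeSum : ∀ {P : Edge → Set} G (c : Flow G) (P? : ∀ e → Dec (P e)) →
  sum (map (λ k → if ⌊ P? (lookup G k) ⌋ then c k else 0) (allFin (length G)))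
    ≡ edgeSum G c (λ e → 𝟙 (P? e))
sum-if-lookup≡edgeSum []      c P? = refl
sum-if-lookup≡edgeSum (e ∷ G) c P? =
  cong₂ _+_ (if-then-0 ⌊ P? e ⌋) (trans (cong sum (map-allFin-suc _)) (sum-if-lookup≡edgeSum G (c ∘ fsuc) P?))
  where
  map-allFin-suc : (g : Fin (suc (length G)) → ℕ) → map g (tabulate fsuc) ≡ map (g ∘ fsuc) (allFin (length G))
  map-allFin-suc g = trans (map-tabulate fsuc g) (sym (map-tabulate (λ k → k) (g ∘ fsuc)))
  if-then-0 : ∀ b → (if b then c fzero else 0) ≡ (if b then 1 else 0) * c fzero
  if-then-0 true  = sym (+-identityʳ _)
  if-then-0 false = refl

length-filter≡edgeSum-unit : ∀ {P : Edge → Set} G (P? : ∀ e → Dec (P e)) →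
                             length (filter P? G) ≡ edgeSum G (unitFlow G) (λ e → 𝟙 (P? e))
length-filter≡edgeSum-unit []      P? = refl
length-filter≡edgeSum-unit (e ∷ G) P? with P? e
... | yes _ = cong suc (length-filter≡edgeSum-unit G P?)
... | no _  = length-filter≡edgeSum-unit G P?

outflow≡edgeSum : ∀ G (c : Flow G) v → outflow G c v ≡ edgeSum G c (λ e → 𝟙 (proj₁ e ≟ v))
outflow≡edgeSum G c v = sum-if-lookup≡edgeSum G c (λ e → proj₁ e ≟ v)

inflow≡edgeSum : ∀ G (c : Flow G) v → inflow G c v ≡ edgeSum G c (λ e → 𝟙 (proj₂ e ≟ v))
inflow≡edgeSum G c v = sum-if-lookup≡edgeSum G c (λ e → proj₂ e ≟ v)

outdeg≡outflow-unit : ∀ G v → outdeg G v ≡ outflow G (unitFlow G) v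
outdeg≡outflow-unit G v =
  trans (length-filter≡edgeSum-unit G (λ e → proj₁ e ≟ v)) (sym (outflow≡edgeSum G (unitFlow G) v))

indeg≡inflow-unit : ∀ G v → indeg G v ≡ inflow G (unitFlow G) v
indeg≡inflow-unit G v =
  trans (length-filter≡edgeSum-unit G (λ e → proj₂ e ≟ v)) (sym (inflow≡edgeSum G (unitFlow G) v))

Spans : ℕ → Edge → Set
Spans i (x , y) = x < i × i < y

spans? : ∀ i e → Dec (Spans i e)
spans? i (x , y) = x <? i ×-dec i <? y

𝟙[tail<]≡𝟙[head≤]+𝟙[spans] : ∀ {x y} i → x < y → 𝟙 (x <? i) ≡ 𝟙 (y <? suc i) + 𝟙 (spans? i (x , y))
𝟙[tail<]≡𝟙[head≤]+𝟙[spans] {x} {y} i x<y with y <? suc i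
... | yes y≤i rewrite 𝟙-yes (x <? i) (<-≤-trans x<y (≤-pred y≤i))
                    | 𝟙-no (spans? i (x , y)) (λ (_ , i<y) → <⇒≱ i<y (≤-pred y≤i)) = refl
... | no y≰i = sym (𝟙-×-dec-yesʳ (x <? i) (i <? y) (≰⇒> (y≰i ∘ s≤s)))

𝟙[tail<]-split : ∀ {x y} i → x < y →
                 𝟙 (x <? i) ≡ 𝟙 (y <? i) + (𝟙 (y ≟ i) + 𝟙 (spans? i (x , y)))
𝟙[tail<]-split {x} {y} i x<y = begin
  𝟙 (x <? i)                                          ≡⟨ 𝟙[tail<]≡𝟙[head≤]+𝟙[spans] i x<y ⟩
  𝟙 (y <? suc i) + 𝟙 (spans? i (x , y))               ≡⟨ cong (_+ 𝟙 (spans? i (x , y))) (𝟙[<]+𝟙[≡]≡𝟙[≤] y i) ⟨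
  (𝟙 (y <? i) + 𝟙 (y ≟ i)) + 𝟙 (spans? i (x , y))     ≡⟨ +-assoc (𝟙 (y <? i)) _ _ ⟩
  𝟙 (y <? i) + (𝟙 (y ≟ i) + 𝟙 (spans? i (x , y)))     ∎
  where open ≡-Reasoning

sumTo-edgeSum-𝟙[≡] : ∀ G (c : Flow G) (p : Edge → ℕ) m → All (λ e → 1 ≤ p e) G →
                     sumTo m (λ v → edgeSum G c (λ e → 𝟙 (p e ≟ v))) ≡ edgeSum G c (λ e → 𝟙 (p e <? suc m))
sumTo-edgeSum-𝟙[≡] G c p m p≥1 =
  trans (sumTo-edgeSum G c (λ v e → 𝟙 (p e ≟ v)) m)
        (edgeSum-cong c p≥1 (λ e 1≤pe → sumTo-𝟙[≡] m 1≤pe))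

cut-balance : ∀ {n G} → All (ValidEdge n) G → (c : Flow G) → ∀ m →
  sumTo m (outflow G c) ≡ sumTo m (inflow G c) + (inflow G c (suc m) + edgeSum G c (λ e → 𝟙 (spans? (suc m) e)))
cut-balance {G = G} valid c m = begin
  sumTo m (outflow G c)                                 ≡⟨ sumTo-cong m (outflow≡edgeSum G c) ⟩
  sumTo m (λ v → edgeSum G c (λ e → 𝟙 (proj₁ e ≟ v)))   ≡⟨ sumTo-edgeSum-𝟙[≡] G c proj₁ m (All.map tail≥1 valid) ⟩
  edgeSum G c (λ e → 𝟙 (proj₁ e <? i))                  ≡⟨ edgeSum-cong c valid (λ _ (_ , x<y , _) → 𝟙[tail<]-split i x<y) ⟩
  edgeSum G c (λ e → 𝟙 (proj₂ e <? i) + (entersᵢ e + spansᵢ e))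
    ≡⟨ trans (edgeSum-+ G c _ _) (cong (_+_ (edgeSum G c (λ e → 𝟙 (proj₂ e <? i)))) (edgeSum-+ G c _ _)) ⟩
  edgeSum G c (λ e → 𝟙 (proj₂ e <? i)) + (edgeSum G c entersᵢ + edgeSum G c spansᵢ)
    ≡⟨ cong₂ _+_ (sym (sumTo-edgeSum-𝟙[≡] G c proj₂ m (All.map head≥1 valid)))
                 (cong (_+ edgeSum G c spansᵢ) (sym (inflow≡edgeSum G c i))) ⟩
  sumTo m (λ v → edgeSum G c (λ e → 𝟙 (proj₂ e ≟ v))) + (inflow G c i + edgeSum G c spansᵢ)
    ≡⟨ cong (_+ (inflow G c i + edgeSum G c spansᵢ)) (sumTo-cong m (sym ∘ inflow≡edgeSum G c)) ⟩
  sumTo m (inflow G c) + (inflow G c i + edgeSum G c spansᵢ) ∎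
  where
  open ≡-Reasoning
  i = suc m
  entersᵢ spansᵢ : Edge → ℕ
  entersᵢ e = 𝟙 (proj₂ e ≟ i)
  spansᵢ e = 𝟙 (spans? i e)
  tail≥1 : ∀ {n e} → ValidEdge n e → 1 ≤ proj₁ e
  tail≥1 (1≤x , _ , _) = 1≤x
  head≥1 : ∀ {n e} → ValidEdge n e → 1 ≤ proj₂ e
  head≥1 (1≤x , x<y , _) = ≤-trans 1≤x (<⇒≤ x<y)

flow-across-cut : ∀ {n G} → All (ValidEdge n) G → (c : Flow G) (c₀ δ : ℕ) →
  outflow G c 1 ≡ inflow G c 1 + c₀ →
  (∀ v → 2 ≤ v → v ≤ n → outflow G c v ≡ inflow G c v + δ) →
  ∀ j → suc j ≤ n → inflow G c (2 + j) + edgeSum G c (λ e → 𝟙 (spans? (2 + j) e)) ≡ c₀ + j * δ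
flow-across-cut {G = G} valid c c₀ δ first mid j j<n =
  +-cancelˡ-≡ (sumTo (suc j) (inflow G c)) _ _
    (trans (sym (cut-balance valid c (suc j)))
           (sumTo-excess (outflow G c) (inflow G c) c₀ δ first mid j j<n))

+m-+n≡+k⇒m≡n+k : ∀ {m n k} → + m ℤ.- + n ≡ + k → m ≡ n + k
+m-+n≡+k⇒m≡n+k {m} {n} {k} eq = ℤ.+-injective (begin
  + m                   ≡⟨ x≡x-y+y (+ m) (+ n) ⟩
  (+ m ℤ.- + n) ℤ.+ + n  ≡⟨ cong (ℤ._+ + n) eq ⟩
  + k ℤ.+ + n           ≡⟨ ℤ.pos-+ k n ⟨
  + (k + n)             ≡⟨ cong +_ (+-comm k n) ⟩
  + (n + k)             ∎)
  where
  open ≡-Reasoning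
  x≡x-y+y : ∀ x y → x ≡ (x ℤ.- y) ℤ.+ y
  x≡x-y+y = ℤ-Solver.solve-∀

m≡n+k⇒+m-+n≡+k : ∀ {m n k} → m ≡ n + k → + m ℤ.- + n ≡ + k
m≡n+k⇒+m-+n≡+k {n = n} {k} refl =
  trans (cong (ℤ._- + n) (ℤ.pos-+ n k)) (x+y-x≡y (+ n) (+ k))
  where
  x+y-x≡y : ∀ x y → (x ℤ.+ y) ℤ.- x ≡ y
  x+y-x≡y = ℤ-Solver.solve-∀

netflow-first : ∀ {n} G f → HasNetflow n G f (w n) → outflow G f 1 ≡ inflow G f 1 + 0
netflow-first G f net = +m-+n≡+k⇒m≡n+k (net 1 ≤-refl (s≤s z≤n))

netflow-mid : ∀ {n} G f → HasNetflow n G f (w n) →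
              ∀ v → 2 ≤ v → v ≤ n → outflow G f v ≡ inflow G f v + 1
netflow-mid {n} G f net v 2≤v v≤n = +m-+n≡+k⇒m≡n+k (trans (net v (<⇒≤ 2≤v) (m≤n⇒m≤1+n v≤n)) w-mid)
  where
  w-mid : w n v ≡ + 1
  w-mid with v ≟ 1
  ... | yes refl = contradiction 2≤v (<-irrefl refl)
  ... | no _ with v ≟ suc n
  ...   | yes refl = contradiction v≤n (<-irrefl refl)
  ...   | no _ = refl

module _ {n G} (G∈F : InF3 n G) where
  open InF3 G∈F

  degree-first : outflow G (unitFlow G) 1 ≡ inflow G (unitFlow G) 1 + 3
  degree-first = begin
    outflow G (unitFlow G) 1      ≡⟨ outdeg≡outflow-unit G 1 ⟨
    outdeg G 1                    ≡⟨ out-first ⟩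
    3                             ≡⟨ cong (_+ 3) (trans (sym in-first) (indeg≡inflow-unit G 1)) ⟩
    inflow G (unitFlow G) 1 + 3   ∎
    where open ≡-Reasoning

  degree-mid : ∀ v → 2 ≤ v → v ≤ n → outflow G (unitFlow G) v ≡ inflow G (unitFlow G) v + 0
  degree-mid v 2≤v v≤n = begin
    outflow G (unitFlow G) v      ≡⟨ outdeg≡outflow-unit G v ⟨
    outdeg G v                    ≡⟨ trans (out-mid v 2≤v v≤n) (sym (in-mid v 2≤v v≤n)) ⟩
    indeg G v                     ≡⟨ indeg≡inflow-unit G v ⟩
    inflow G (unitFlow G) v       ≡⟨ +-identityʳ _ ⟨
    inflow G (unitFlow G) v + 0   ∎
    where open ≡-Reasoning

  unique-spanning-edge : ∀ j → 2 + j ≤ n → edgeSum G (unitFlow G) (λ e → 𝟙 (spans? (2 + j) e)) ≡ 1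
  unique-spanning-edge j i≤n = +-cancelˡ-≡ 2 _ _ (begin
    2 + spanners                                   ≡⟨ cong (_+ spanners) (trans (sym (in-mid (2 + j) (s≤s (s≤s z≤n)) i≤n))
                                                                               (indeg≡inflow-unit G (2 + j))) ⟩
    inflow G (unitFlow G) (2 + j) + spanners       ≡⟨ flow-across-cut valid (unitFlow G) 3 0 degree-first degree-mid j
                                                                      (≤-trans (n≤1+n _) i≤n) ⟩
    3 + j * 0                                      ≡⟨ cong (_+_ 3) (*-zeroʳ j) ⟩
    3                                              ∎)
    where
    open ≡-Reasoning
    spanners = edgeSum G (unitFlow G) (λ e → 𝟙 (spans? (2 + j) e))

proposition3p16 : (n : ℕ) (G : DAG) → InF3 n G → (i : ℕ) → 2 ≤ i → i ≤ n
                  → (k : Fin (length G)) (a d : ℕ) → lookup G k ≡ (a , d) → a < i → i < d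
                  → (f : Flow G) → HasNetflow n G f (w n)
                  → + inflow G f i ≡ (+ i ℤ.- + 2) ℤ.- + f k
proposition3p16 n G G∈F (suc (suc j)) (s≤s (s≤s z≤n)) i≤n k a d eqk a<i i<d f net =
  sym (m≡n+k⇒+m-+n≡+k (begin
    j                                  ≡⟨ *-identityʳ j ⟨
    0 + j * 1                          ≡⟨ flow-across-cut (InF3.valid G∈F) f 0 1 (netflow-first G f net) (netflow-mid G f net)
                                                          j (≤-trans (n≤1+n _) i≤n) ⟨
    inflow G f i + edgeSum G f spansᵢ  ≡⟨ cong (_+_ (inflow G f i)) spanning-flow ⟩
    inflow G f i + f k                 ≡⟨ +-comm _ (f k) ⟩
    f k + inflow G f i                 ∎))
  where
  open ≡-Reasoning
  i = suc (suc j)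
  spansᵢ : Edge → ℕ
  spansᵢ e = 𝟙 (spans? i e)
  spanning-flow : edgeSum G f spansᵢ ≡ f k
  spanning-flow = edgeSum-unit≡1⇒≡lookup G f spansᵢ k (unique-spanning-edge G∈F j i≤n)
                    (𝟙-yes (spans? i (lookup G k)) (subst (Spans i) (sym eqk) (a<i , i<d)))
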